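{- Let $G$ be a finite permutation group acting transitively on a set $\Omega$, $n=|\Omega|$, and let $\mathds{1}$ be the all-ones vector. Then $G$ is nonspreading if and only if there are nontrivial vectors $u,v\in\mathbb{Q}\Omega$ such that: (i) $u$ is a $\{0,1\}$-vector; (ii) $v$ has non-negative integer entries; (iii) $v\cdot\mathds{1}$ divides $|\Omega|$; (iv) $vD(u)v^{\top}=\frac{1}{n^2}(u\cdot\mathds{1})^2(v\cdot\mathds{1})^2$.
   Context: Vectors are row vectors indexed by a fixed ordering of $\Omega$; $v^g$ is $v$ with coordinates permuted by $g\in G$. A vector with non-negative entries (or the set/multiset whose characteristic/multiplicity vector $\chi$ it is) is called nontrivial if it has at least two distinct entries and at most $n-2$ zero entries. $G$ is nonspreading if there exist a nontrivial multiset $A$ of elements of $\Omega$, a nontrivial subset $B\subseteq\Omega$ and a positive integer $\lambda$ such that $|A|$ divides $|\Omega|$ and $\chi_A\cdot\chi_{B^g}=\lambda$ for all $g\in G$. Let $A_0=I,\dots,A_d$ be the $0/1$ adjacency matrices of the orbitals of $G$ (orbits of $G$ on $\Omega\times\Omega$), $k_i=\operatorname{tr}(A_iA_i^{\top})$, and for $u\in\mathbb{C}\Omega$, $D(u)=\sum_{i=0}^d\frac{1}{k_i}(uA_i^{\top}u^*)A_i$. -}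

module Defs where

open import Data.Nat as ℕ using (ℕ; zero; suc; _∸_)
open import Data.Nat.Divisibility using (_∣_)
open import Data.Integer as ℤ using (ℤ; +_)
open import Data.Rational as ℚ using (ℚ; 0ℚ; 1ℚ; _+_; _*_; _/_; _≤_)
open import Data.Rational.Properties using (_≟_)
open import Data.Fin using (Fin)
import Data.Fin
import Data.Bool
import Relation.Nullary.Decidable
open import Data.Fin.Properties as FinP using ()
open import Data.Bool using (Bool; true; false)
open import Data.List using (List; []; _∷_)
open import Data.List.Membership.Propositional using (_∈_)
open import Data.List.Relation.Unary.Any as Any using (Any; any?)
open import Data.Product using (Σ; _×_; _,_; ∃; ∃₂)
open import Data.Sum using (_⊎_)
open import Function.Bundles using (_↔_; Inverse)
open import Relation.Binary.PropositionalEquality using (_≡_; _≢_)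
open import Relation.Binary using (DecidableEquality)
open import Relation.Nullary using (Dec; yes; no)
open import Relation.Nullary.Decidable using (_×-dec_)

-- Ω = Fin n.  Vectors over a type A indexed by Ω are functions Fin n → A.

Σℚ : ∀ {n} → (Fin n → ℚ) → ℚ
Σℚ {zero}  f = 0ℚ
Σℚ {suc n} f = f Data.Fin.zero + Σℚ {n} (λ i → f (Data.Fin.suc i))

Σℕ : ∀ {n} → (Fin n → ℕ) → ℕ
Σℕ {zero}  f = 0
Σℕ {suc n} f = f Data.Fin.zero ℕ.+ Σℕ {n} (λ i → f (Data.Fin.suc i))

countFin : ∀ {n} {A : Set} → (A → Bool) → (Fin n → A) → ℕ
countFin {n} p v = Σℕ (λ i → Data.Bool.if p (v i) then 1 else 0)

ℕ→ℚ : ℕ → ℚ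
ℕ→ℚ m = (+ m) / 1

_·_ : ∀ {n} → (Fin n → ℚ) → (Fin n → ℚ) → ℚ
x · y = Σℚ (λ i → x i * y i)

𝟙 : ∀ {n} → Fin n → ℚ
𝟙 _ = 1ℚ

isZeroℚ : ℚ → Bool
isZeroℚ q = Relation.Nullary.Decidable.⌊ q ≟ 0ℚ ⌋

isZeroℕ : ℕ → Bool
isZeroℕ m = Relation.Nullary.Decidable.⌊ m ℕ.≟ 0 ⌋

NontrivialℚVec : (n : ℕ) → (Fin n → ℚ) → Set
NontrivialℚVec n v =
  (∀ i → 0ℚ ℚ.≤ v i) ×
  (∃₂ λ i j → v i ≢ v j) ×
  (countFin isZeroℚ v ℕ.≤ n ∸ 2)

-- a multiset of elements of Ω, given by its multiplicity vector χ_A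
NontrivialℕVec : (n : ℕ) → (Fin n → ℕ) → Set
NontrivialℕVec n v =
  (∃₂ λ i j → v i ≢ v j) ×
  (countFin isZeroℕ v ℕ.≤ n ∸ 2)

-- a subset of Ω, given by its characteristic vector
χBool : Bool → ℕ
χBool true  = 1
χBool false = 0

NontrivialSubset : (n : ℕ) → (Fin n → Bool) → Set
NontrivialSubset n B = NontrivialℕVec n (λ i → χBool (B i))

Perm : ℕ → Set
Perm n = Fin n ↔ Fin n

app : ∀ {n} → Perm n → Fin n → Fin n
app g = Inverse.to g

inv : ∀ {n} → Perm n → Fin n → Fin n
inv g = Inverse.from g

record PermGroup (n : ℕ) : Set where
  field
    elems   : List (Perm n)
    has-id  : ∃ λ e → e ∈ elems × (∀ x → app e x ≡ x)
    has-∘   : ∀ {g h} → g ∈ elems → h ∈ elems →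
              ∃ λ k → k ∈ elems × (∀ x → app k x ≡ app g (app h x))
    has-inv : ∀ {g} → g ∈ elems →
              ∃ λ k → k ∈ elems × (∀ x → app k x ≡ inv g x)

open PermGroup public

Transitive : ∀ {n} → PermGroup n → Set
Transitive {n} G = ∀ α β → ∃ λ g → g ∈ elems G × app g α ≡ β

-- Nonspreading.
-- B^g = { b^g : b ∈ B }, so χ_{B^g}(ω) = χ_B(g⁻¹ ω).

dotℕ : ∀ {n} → (Fin n → ℕ) → (Fin n → ℕ) → ℕ
dotℕ x y = Σℕ (λ i → x i ℕ.* y i)

Nonspreading : ∀ {n} → PermGroup n → Set
Nonspreading {n} G =
  Σ (Fin n → ℕ) λ χA → Σ (Fin n → Bool) λ B → Σ ℕ λ λ′ →
    NontrivialℕVec n χA ×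
    NontrivialSubset n B ×
    (1 ℕ.≤ λ′) ×
    (Σℕ χA ∣ n) ×
    (∀ g → g ∈ elems G →
       dotℕ χA (λ ω → χBool (B (inv g ω))) ≡ λ′)

inOrbital? : ∀ {n} (G : PermGroup n) (α β γ δ : Fin n) →
             Dec (Any (λ g → app g α ≡ γ × app g β ≡ δ) (elems G))
inOrbital? G α β γ δ =
  any? (λ g → (app g α FinP.≟ γ) ×-dec (app g β FinP.≟ δ)) (elems G)

Aorb : ∀ {n} (G : PermGroup n) (α β : Fin n) → Fin n → Fin n → ℚ
Aorb G α β γ δ = Data.Bool.if Relation.Nullary.Decidable.⌊ inOrbital? G α β γ δ ⌋ then 1ℚ else 0ℚ

-- k_i = tr(A_i A_iᵀ) = number of 1-entries of A_i
korb : ∀ {n} (G : PermGroup n) (α β : Fin n) → ℚ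
korb G α β = Σℚ (λ γ → Σℚ (λ δ → Aorb G α β γ δ * Aorb G α β γ δ))

-- 1/k for a nonzero rational k (k_i ≥ 1 always since (α,β) ∈ its orbital)
recip : ℚ → ℚ
recip q with q ≟ 0ℚ
... | yes _ = 0ℚ
... | no q≢0 = ℚ.1/_ q {{ℚ.≢-nonZero q≢0}}

form : ∀ {n} → (Fin n → ℚ) → (Fin n → Fin n → ℚ) → (Fin n → ℚ) → ℚ
form x M y = Σℚ (λ i → Σℚ (λ j → x i * M i j * y j))

transpose : ∀ {n} → (Fin n → Fin n → ℚ) → Fin n → Fin n → ℚ
transpose M i j = M j i

-- D(u) = Σ_i (1/k_i)(u A_iᵀ u*) A_i, for u ∈ ℚΩ (so u* = uᵀ).
-- The (α,β) entry only involves the unique orbital A_i containing (α,β).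
D : ∀ {n} (G : PermGroup n) → (Fin n → ℚ) → Fin n → Fin n → ℚ
D G u α β = recip (korb G α β) * form u (transpose (Aorb G α β)) u

-- For a vector u and g ∈ G write u^g for u moved by g, and f(g) = v · u^g.
-- Averaged over G, f has mean m = (u·𝟙)(v·𝟙)/n by transitivity, and the average of
-- the matrices (u^g)ᵀ u^g is exactly D(u): the number of g ∈ G sending (γ, ω) to (α, β)
-- is |G|/k_i when (γ, ω) lies in the orbital A_i of (α, β) and 0 otherwise.  Hence
-- Σ_g (f(g) − m)² = |G| (v D(u) vᵀ − m²), so condition (iv) says exactly that f is constant
-- on G; for u = χ_B and v = χ_A this is the definition of nonspreading.

module Submission where

open import Defs
open import Data.Nat using (ℕ; _*_)
open import Data.Nat.Divisibility using (_∣_)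
open import Data.Rational as ℚ using (ℚ; 0ℚ; 1ℚ)
open import Data.Fin using (Fin)
open import Data.Product using (Σ; _×_; ∃)
open import Data.Sum using (_⊎_)
open import Function.Bundles using (_⇔_)
open import Relation.Binary.PropositionalEquality using (_≡_)

import Data.Rational.Properties as ℚP
open import Data.Rational.Properties using (_≟_)
open import Algebra.Bundles using (CommutativeRing)
open import Algebra.Apartness.Properties.HeytingCommutativeRing ℚP.heytingCommutativeRing
  using (x#0y#0→xy#0)
open import Algebra.Properties.Group ℚP.+-0-group using (x∙y⁻¹≈ε⇒x≈y)
open import Algebra.Properties.Semiring.Mult (CommutativeRing.semiring ℚP.+-*-commutativeRing)
  using (×-homo-+; ×1-homo-*; ×-assoc-*) renaming (_×_ to _×ℚ_)
open import Algebra.Properties.Semiring.Sum (CommutativeRing.semiring ℚP.+-*-commutativeRing)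
  using (sum-syntax; sum-cong-≗; sum-replicate; sum-replicate-zero; sum-remove; ∑-comm; ∑-distrib-+;
         *-distribˡ-sum; *-distribʳ-sum)
open import Data.Bool using (Bool; true; false; if_then_else_)
open import Data.Empty using (⊥-elim)
open import Data.Fin using (zero; suc; punchIn)
import Data.Fin.Properties as Fin
import Data.Integer as ℤ
import Data.Integer.Properties as ℤP
open import Data.List using (length; lookup)
open import Data.List.Membership.Propositional using (_∈_; find; lose)
open import Data.List.Membership.Propositional.Properties using (∈-lookup)
import Data.List.Relation.Unary.Any as Any
open import Data.List.Relation.Unary.Any.Properties using (lookup-index)
open import Data.Nat as ℕ using (zero; suc; _∸_)
import Data.Nat.Coprimality as Coprime
import Data.Nat.Properties as ℕP
open import Data.Product using (_,_; proj₁; proj₂)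
open import Data.Rational using (mkℚ; ↥_; _+_; _-_; -_; _≤_; _<_) renaming (_*_ to _⋆_)
open import Data.Sum using (inj₁; inj₂; [_,_]′; reduce)
open import Function.Base using (id; _∘_)
open import Function.Bundles using (Inverse; Equivalence; mk⇔)
open import Function.Definitions using (Congruent)
open import Level using (0ℓ)
open import Relation.Binary.PropositionalEquality
  using (_≢_; _≗_; refl; subst; subst₂; sym; trans; cong; cong₂; module ≡-Reasoning)
open import Relation.Nullary using (Dec; yes; no; ¬_; contradiction)
open import Relation.Nullary.Decidable using (isYes; dec⇒maybe; isYes≗does; does-⇔)
open import Tactic.RingSolver using (solve-∀)
open import Tactic.RingSolver.Core.AlmostCommutativeRing using (AlmostCommutativeRing; fromCommutativeRing)

open ≡-Reasoning

-- Rational arithmetic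

-- Without the zero test the normaliser keeps monomials whose coefficients cancel to 0.
ℚ-ring : AlmostCommutativeRing 0ℓ 0ℓ
ℚ-ring = fromCommutativeRing ℚP.+-*-commutativeRing (λ q → dec⇒maybe (0ℚ ≟ q))

ℕ→ℚ≡mkℚ : ∀ m → ℕ→ℚ m ≡ mkℚ (ℤ.+ m) 0 (Coprime.sym (Coprime.1-coprimeTo m))
ℕ→ℚ≡mkℚ m = ℚP.↥p/↧p≡p _

ℕ→ℚ-suc : ∀ m → ℕ→ℚ (suc m) ≡ 1ℚ + ℕ→ℚ m
ℕ→ℚ-suc m = trans (ℚP./-cong (cong (ℤ._+_ ℤ.1ℤ) (sym (ℤP.*-identityʳ (ℤ.+ m)))) refl)
                  (cong (1ℚ +_) (sym (ℕ→ℚ≡mkℚ m)))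

ℕ→ℚ≡×1 : ∀ m → ℕ→ℚ m ≡ m ×ℚ 1ℚ
ℕ→ℚ≡×1 zero    = refl
ℕ→ℚ≡×1 (suc m) = trans (ℕ→ℚ-suc m) (cong (1ℚ +_) (ℕ→ℚ≡×1 m))

ℕ→ℚ-homo-+ : ∀ a b → ℕ→ℚ (a ℕ.+ b) ≡ ℕ→ℚ a + ℕ→ℚ b
ℕ→ℚ-homo-+ a b = trans (ℕ→ℚ≡×1 (a ℕ.+ b))
  (trans (×-homo-+ 1ℚ a b) (sym (cong₂ _+_ (ℕ→ℚ≡×1 a) (ℕ→ℚ≡×1 b))))

ℕ→ℚ-homo-* : ∀ a b → ℕ→ℚ (a * b) ≡ ℕ→ℚ a ⋆ ℕ→ℚ b
ℕ→ℚ-homo-* a b = trans (ℕ→ℚ≡×1 (a * b))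
  (trans (×1-homo-* a b) (sym (cong₂ _⋆_ (ℕ→ℚ≡×1 a) (ℕ→ℚ≡×1 b))))

ℕ→ℚ-injective : ∀ {a b} → ℕ→ℚ a ≡ ℕ→ℚ b → a ≡ b
ℕ→ℚ-injective {a} {b} eq = ℤP.+-injective (begin
  ℤ.+ a      ≡⟨ cong ↥_ (ℕ→ℚ≡mkℚ a) ⟨
  ↥ ℕ→ℚ a    ≡⟨ cong ↥_ eq ⟩
  ↥ ℕ→ℚ b    ≡⟨ cong ↥_ (ℕ→ℚ≡mkℚ b) ⟩
  ℤ.+ b      ∎)

ℕ→ℚ-nonNeg : ∀ m → 0ℚ ≤ ℕ→ℚ m
ℕ→ℚ-nonNeg m = ℚP.nonNegative⁻¹ _ {{ℚP.normalize-nonNeg m 1}}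

ℕ→ℚ-suc≢0 : ∀ m → ℕ→ℚ (suc m) ≢ 0ℚ
ℕ→ℚ-suc≢0 m eq with () ← ℕ→ℚ-injective {suc m} {0} eq

Fin⇒ℕ→ℚ≢0 : ∀ {n} → Fin n → ℕ→ℚ n ≢ 0ℚ
Fin⇒ℕ→ℚ≢0 {suc m} _ = ℕ→ℚ-suc≢0 m

recip-inverseˡ : ∀ {q} → q ≢ 0ℚ → recip q ⋆ q ≡ 1ℚ
recip-inverseˡ {q} q≢0 with q ≟ 0ℚ
... | yes q≡0 = ⊥-elim (q≢0 q≡0)
... | no  q≢0 = ℚP.*-inverseˡ q {{ℚ.≢-nonZero q≢0}}

recip-inverseʳ : ∀ {q} → q ≢ 0ℚ → q ⋆ recip q ≡ 1ℚ
recip-inverseʳ {q} q≢0 = trans (ℚP.*-comm q (recip q)) (recip-inverseˡ q≢0)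

recip≢0 : ∀ {q} → q ≢ 0ℚ → recip q ≢ 0ℚ
recip≢0 {q} q≢0 r≡0 = ℚP.1≢0 (begin
  1ℚ          ≡⟨ recip-inverseˡ q≢0 ⟨
  recip q ⋆ q ≡⟨ cong (_⋆ q) r≡0 ⟩
  0ℚ ⋆ q      ≡⟨ ℚP.*-zeroˡ q ⟩
  0ℚ          ∎)

recip-pos : ∀ {q} → 0ℚ < q → 0ℚ < recip q
recip-pos {q} 0<q with q ≟ 0ℚ
... | yes q≡0 = ⊥-elim (ℚP.<-irrefl (sym q≡0) 0<q)
... | no  q≢0 = ℚP.positive⁻¹ _ {{ℚP.1/pos⇒pos q {{ℚ.positive 0<q}}}}

recip-*-cancelˡ : ∀ {a x} → a ≢ 0ℚ → recip a ⋆ (a ⋆ x) ≡ x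
recip-*-cancelˡ {a} {x} a≢0 = begin
  recip a ⋆ (a ⋆ x)  ≡⟨ ℚP.*-assoc (recip a) a x ⟨
  recip a ⋆ a ⋆ x    ≡⟨ cong (_⋆ x) (recip-inverseˡ a≢0) ⟩
  1ℚ ⋆ x             ≡⟨ ℚP.*-identityˡ x ⟩
  x                  ∎

a*x≡b⇒x≡recip[a]*b : ∀ {a x b} → a ≢ 0ℚ → a ⋆ x ≡ b → x ≡ recip a ⋆ b
a*x≡b⇒x≡recip[a]*b {a} a≢0 eq = trans (sym (recip-*-cancelˡ a≢0)) (cong (recip a ⋆_) eq)

*-cancelˡ-≡ : ∀ {a x y} → a ≢ 0ℚ → a ⋆ x ≡ a ⋆ y → x ≡ y
*-cancelˡ-≡ {a} a≢0 eq = trans (a*x≡b⇒x≡recip[a]*b a≢0 eq) (recip-*-cancelˡ a≢0)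

a*b≡0⇒a≡0∨b≡0 : ∀ {a b} → a ⋆ b ≡ 0ℚ → a ≡ 0ℚ ⊎ b ≡ 0ℚ
a*b≡0⇒a≡0∨b≡0 {a} {b} ab≡0 with a ≟ 0ℚ
... | yes a≡0 = inj₁ a≡0
... | no  a≢0 = inj₂ (trans (a*x≡b⇒x≡recip[a]*b a≢0 ab≡0) (ℚP.*-zeroʳ (recip a)))

x*x≡0⇒x≡0 : ∀ {x} → x ⋆ x ≡ 0ℚ → x ≡ 0ℚ
x*x≡0⇒x≡0 xx≡0 = reduce (a*b≡0⇒a≡0∨b≡0 xx≡0)

recip-* : ∀ {a b} → a ≢ 0ℚ → b ≢ 0ℚ → recip (a ⋆ b) ≡ recip a ⋆ recip b
recip-* {a} {b} a≢0 b≢0 = begin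
  recip (a ⋆ b)                ≡⟨ ℚP.*-identityʳ _ ⟨
  recip (a ⋆ b) ⋆ 1ℚ           ≡⟨ a*x≡b⇒x≡recip[a]*b (x#0y#0→xy#0 a≢0 b≢0) (begin
    a ⋆ b ⋆ (recip a ⋆ recip b)  ≡⟨ interchange a b (recip a) (recip b) ⟩
    recip a ⋆ a ⋆ (recip b ⋆ b)  ≡⟨ cong₂ _⋆_ (recip-inverseˡ a≢0) (recip-inverseˡ b≢0) ⟩
    1ℚ                           ∎) ⟨
  recip a ⋆ recip b            ∎
  where
  interchange : ∀ a b c d → a ⋆ b ⋆ (c ⋆ d) ≡ c ⋆ a ⋆ (d ⋆ b)
  interchange = solve-∀ ℚ-ring

*-nonNeg : ∀ {a b} → 0ℚ ≤ a → 0ℚ ≤ b → 0ℚ ≤ a ⋆ b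
*-nonNeg {a} {b} 0≤a 0≤b =
  ℚP.nonNegative⁻¹ _ {{ℚP.nonNeg*nonNeg⇒nonNeg a {{ℚ.nonNegative 0≤a}} b {{ℚ.nonNegative 0≤b}}}}

x*x-nonNeg : ∀ x → 0ℚ ≤ x ⋆ x
x*x-nonNeg x with ℚP.≤-total 0ℚ x
... | inj₁ 0≤x = *-nonNeg 0≤x 0≤x
... | inj₂ x≤0 =
  ℚP.nonNegative⁻¹ _ {{ℚP.nonPos*nonPos⇒nonPos x {{ℚ.nonPositive x≤0}} x {{ℚ.nonPositive x≤0}}}}

nonNeg∧≢0⇒pos : ∀ {q} → 0ℚ ≤ q → q ≢ 0ℚ → 0ℚ < q
nonNeg∧≢0⇒pos {q} 0≤q q≢0 =
  ℚP.positive⁻¹ q {{ℚP.nonNeg∧nonZero⇒pos q {{ℚ.nonNegative 0≤q}} {{ℚ.≢-nonZero q≢0}}}}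

-- Indicators and finite sums

isYes-⇔ : ∀ {P Q : Set} → P ⇔ Q → (d : Dec P) (e : Dec Q) → isYes d ≡ isYes e
isYes-⇔ P⇔Q d e = trans (isYes≗does d) (trans (does-⇔ P⇔Q d e) (sym (isYes≗does e)))

indicator : ∀ {P : Set} → Dec P → ℚ
indicator d = if isYes d then 1ℚ else 0ℚ

indicator-yes : ∀ {P : Set} → P → (d : Dec P) → indicator d ≡ 1ℚ
indicator-yes p (yes _) = refl
indicator-yes p (no ¬p) = contradiction p ¬p

indicator-no : ∀ {P : Set} → ¬ P → (d : Dec P) → indicator d ≡ 0ℚ
indicator-no ¬p (yes p) = contradiction p ¬p
indicator-no ¬p (no _)  = refl

indicator-cong : ∀ {P Q : Set} → (P → Q) → (Q → P) → (d : Dec P) (e : Dec Q) → indicator d ≡ indicator e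
indicator-cong P→Q Q→P d e = cong (if_then 1ℚ else 0ℚ) (isYes-⇔ (mk⇔ P→Q Q→P) d e)

indicator-*-cong : ∀ {P : Set} (d : Dec P) {a b} → (P → a ≡ b) → indicator d ⋆ a ≡ indicator d ⋆ b
indicator-*-cong (yes p) a≡b = cong (1ℚ ⋆_) (a≡b p)
indicator-*-cong (no _) {a} {b} _ = trans (ℚP.*-zeroˡ a) (sym (ℚP.*-zeroˡ b))

indicator-idem : ∀ {P : Set} (d : Dec P) → indicator d ⋆ indicator d ≡ indicator d
indicator-idem (yes _) = refl
indicator-idem (no _)  = refl

indicator-nonNeg : ∀ {P : Set} (d : Dec P) → 0ℚ ≤ indicator d
indicator-nonNeg (yes _) = ℚP.nonNegative⁻¹ 1ℚ
indicator-nonNeg (no _)  = ℚP.≤-refl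

Σℚ≡∑ : ∀ {n} (f : Fin n → ℚ) → Σℚ f ≡ ∑[ i < n ] f i
Σℚ≡∑ {zero}  f = refl
Σℚ≡∑ {suc n} f = cong (f zero +_) (Σℚ≡∑ (f ∘ suc))

·≡∑ : ∀ {n} (x y : Fin n → ℚ) → x · y ≡ ∑[ i < n ] (x i ⋆ y i)
·≡∑ x y = Σℚ≡∑ (λ i → x i ⋆ y i)

·𝟙≡∑ : ∀ {n} (x : Fin n → ℚ) → x · 𝟙 ≡ ∑[ i < n ] x i
·𝟙≡∑ x = trans (·≡∑ x 𝟙) (sum-cong-≗ (ℚP.*-identityʳ ∘ x))

form≡∑∑ : ∀ {n} (x : Fin n → ℚ) M y → form x M y ≡ ∑[ i < n ] ∑[ j < n ] (x i ⋆ M i j ⋆ y j)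
form≡∑∑ x M y = trans (Σℚ≡∑ (λ i → Σℚ (λ j → x i ⋆ M i j ⋆ y j)))
                      (sum-cong-≗ (λ i → Σℚ≡∑ (λ j → x i ⋆ M i j ⋆ y j)))

form-transpose : ∀ {n} (x : Fin n → ℚ) M → form x (transpose M) x ≡ form x M x
form-transpose {n} x M = begin
  form x (transpose M) x                     ≡⟨ form≡∑∑ x (transpose M) x ⟩
  ∑[ i < n ] ∑[ j < n ] (x i ⋆ M j i ⋆ x j)  ≡⟨ ∑-comm (λ i j → x i ⋆ M j i ⋆ x j) ⟩
  ∑[ j < n ] ∑[ i < n ] (x i ⋆ M j i ⋆ x j)  ≡⟨ sum-cong-≗ (λ j → sum-cong-≗ (λ i → swap (x i) (M j i) (x j))) ⟩
  ∑[ j < n ] ∑[ i < n ] (x j ⋆ M j i ⋆ x i)  ≡⟨ form≡∑∑ x M x ⟨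
  form x M x                                 ∎
  where
  swap : ∀ a m b → a ⋆ m ⋆ b ≡ b ⋆ m ⋆ a
  swap = solve-∀ ℚ-ring

∑-const : ∀ n c → ∑[ i < n ] c ≡ ℕ→ℚ n ⋆ c
∑-const n c = begin
  ∑[ i < n ] c          ≡⟨ sum-replicate n ⟩
  n ×ℚ c                ≡⟨ cong (n ×ℚ_) (ℚP.*-identityˡ c) ⟨
  n ×ℚ (1ℚ ⋆ c)         ≡⟨ ×-assoc-* n 1ℚ c ⟨
  n ×ℚ 1ℚ ⋆ c           ≡⟨ cong (_⋆ c) (ℕ→ℚ≡×1 n) ⟨
  ℕ→ℚ n ⋆ c             ∎

∑-*-∑ : ∀ {m n} (f : Fin m → ℚ) (g : Fin n → ℚ) →
        (∑[ i < m ] f i) ⋆ (∑[ j < n ] g j) ≡ ∑[ i < m ] ∑[ j < n ] (f i ⋆ g j)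
∑-*-∑ f g = trans (*-distribʳ-sum _ f) (sum-cong-≗ (λ i → *-distribˡ-sum (f i) g))

*-distribˡ-∑∑ : ∀ {m n} c (f : Fin m → Fin n → ℚ) →
                c ⋆ ∑[ i < m ] ∑[ j < n ] f i j ≡ ∑[ i < m ] ∑[ j < n ] (c ⋆ f i j)
*-distribˡ-∑∑ {n = n} c f =
  trans (*-distribˡ-sum c (λ i → ∑[ j < n ] f i j)) (sum-cong-≗ (λ i → *-distribˡ-sum c (f i)))

∑-nonNeg : ∀ {n} {f : Fin n → ℚ} → (∀ i → 0ℚ ≤ f i) → 0ℚ ≤ ∑[ i < n ] f i
∑-nonNeg {zero}  f≥0 = ℚP.≤-refl
∑-nonNeg {suc n} f≥0 = ℚP.+-mono-≤ (f≥0 zero) (∑-nonNeg (f≥0 ∘ suc))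

∑-nonNeg-≡0 : ∀ {n} {f : Fin n → ℚ} → (∀ i → 0ℚ ≤ f i) →
              ∑[ i < n ] f i ≡ 0ℚ → ∀ i → f i ≡ 0ℚ
∑-nonNeg-≡0 {suc n} {f} f≥0 ∑f≡0 i = ℚP.≤-antisym fᵢ≤0 (f≥0 i)
  where
  fᵢ≤0 : f i ≤ 0ℚ
  fᵢ≤0 = subst₂ _≤_ (ℚP.+-identityʳ (f i)) (trans (sym (sum-remove f)) ∑f≡0)
                (ℚP.+-monoʳ-≤ (f i) (∑-nonNeg (f≥0 ∘ punchIn i)))

ℕ→ℚ-Σℕ : ∀ {n} (f : Fin n → ℕ) → ℕ→ℚ (Σℕ f) ≡ ∑[ i < n ] ℕ→ℚ (f i)
ℕ→ℚ-Σℕ {zero}  f = refl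
ℕ→ℚ-Σℕ {suc n} f =
  trans (ℕ→ℚ-homo-+ (f zero) (Σℕ (f ∘ suc))) (cong (ℕ→ℚ (f zero) +_) (ℕ→ℚ-Σℕ (f ∘ suc)))

Σℕ-cong : ∀ {n} {f g : Fin n → ℕ} → (∀ i → f i ≡ g i) → Σℕ f ≡ Σℕ g
Σℕ-cong {zero}  f≗g = refl
Σℕ-cong {suc n} f≗g = cong₂ ℕ._+_ (f≗g zero) (Σℕ-cong (f≗g ∘ suc))

-- Natural-number data as rational vectors

χBool-01 : ∀ b → ℕ→ℚ (χBool b) ≡ 0ℚ ⊎ ℕ→ℚ (χBool b) ≡ 1ℚ
χBool-01 false = inj₁ refl
χBool-01 true  = inj₂ refl

01⇒χBool : ∀ {q} → q ≡ 0ℚ ⊎ q ≡ 1ℚ → ∃ λ b → q ≡ ℕ→ℚ (χBool b)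
01⇒χBool (inj₁ q≡0) = false , q≡0
01⇒χBool (inj₂ q≡1) = true  , q≡1

nontrivial-ℕ→ℚ : ∀ {n} {x : Fin n → ℚ} {a : Fin n → ℕ} → (∀ i → x i ≡ ℕ→ℚ (a i)) →
                 NontrivialℚVec n x ⇔ NontrivialℕVec n a
nontrivial-ℕ→ℚ {n} {x} {a} x≗a = mk⇔
  (λ (_ , (i , j , xᵢ≢xⱼ) , few-zeros) →
     (i , j , λ aᵢ≡aⱼ → xᵢ≢xⱼ (trans (x≗a i) (trans (cong ℕ→ℚ aᵢ≡aⱼ) (sym (x≗a j))))) ,
     subst (ℕ._≤ n ∸ 2) same-zeros few-zeros)
  (λ ((i , j , aᵢ≢aⱼ) , few-zeros) →
     (λ k → subst (0ℚ ≤_) (sym (x≗a k)) (ℕ→ℚ-nonNeg (a k))) ,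
     (i , j , λ xᵢ≡xⱼ → aᵢ≢aⱼ (ℕ→ℚ-injective (trans (sym (x≗a i)) (trans xᵢ≡xⱼ (x≗a j))))) ,
     subst (ℕ._≤ n ∸ 2) (sym same-zeros) few-zeros)
  where
  same-zeros : countFin isZeroℚ x ≡ countFin isZeroℕ a
  same-zeros = Σℕ-cong (λ i → cong (if_then 1 else 0) (trans (cong isZeroℚ (x≗a i))
    (isYes-⇔ (mk⇔ ℕ→ℚ-injective (cong ℕ→ℚ)) (ℕ→ℚ (a i) ≟ 0ℚ) (a i ℕ.≟ 0))))

nontrivial⇒·𝟙≢0 : ∀ {n} {x : Fin n → ℚ} → NontrivialℚVec n x → x · 𝟙 ≢ 0ℚ
nontrivial⇒·𝟙≢0 {x = x} (x≥0 , (i , j , xᵢ≢xⱼ) , _) x·𝟙≡0 =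
  xᵢ≢xⱼ (trans (vanishes i) (sym (vanishes j)))
  where
  vanishes : ∀ i → x i ≡ 0ℚ
  vanishes = ∑-nonNeg-≡0 x≥0 (trans (sym (·𝟙≡∑ x)) x·𝟙≡0)

·𝟙≡ℕ→ℚ-Σℕ : ∀ {n} {x : Fin n → ℚ} {a : Fin n → ℕ} →
             (∀ i → x i ≡ ℕ→ℚ (a i)) → x · 𝟙 ≡ ℕ→ℚ (Σℕ a)
·𝟙≡ℕ→ℚ-Σℕ {x = x} {a} x≗a = trans (·𝟙≡∑ x) (trans (sum-cong-≗ x≗a) (sym (ℕ→ℚ-Σℕ a)))

-- Kronecker delta and pushforward along maps of Ω

δ : ∀ {n} → Fin n → Fin n → ℚ
δ x y = indicator (x Fin.≟ y)

∑-δ : ∀ {n} (f : Fin n → ℚ) α → ∑[ γ < n ] (f γ ⋆ δ γ α) ≡ f α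
∑-δ {suc n} f α = begin
  ∑[ γ < suc n ] (f γ ⋆ δ γ α)
    ≡⟨ sum-remove (λ γ → f γ ⋆ δ γ α) ⟩
  f α ⋆ δ α α + ∑[ j < n ] (f (punchIn α j) ⋆ δ (punchIn α j) α)
    ≡⟨ cong₂ _+_ f[α]δ≡f[α] (sum-cong-≗ off-diagonal) ⟩
  f α + ∑[ j < n ] 0ℚ
    ≡⟨ cong (f α +_) (sum-replicate-zero n) ⟩
  f α + 0ℚ
    ≡⟨ ℚP.+-identityʳ (f α) ⟩
  f α ∎
  where
  f[α]δ≡f[α] : f α ⋆ δ α α ≡ f α
  f[α]δ≡f[α] = trans (cong (f α ⋆_) (indicator-yes refl (α Fin.≟ α))) (ℚP.*-identityʳ (f α))
  off-diagonal : ∀ j → f (punchIn α j) ⋆ δ (punchIn α j) α ≡ 0ℚ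
  off-diagonal j = trans (cong (f (punchIn α j) ⋆_) (indicator-no (Fin.punchInᵢ≢i α j) (punchIn α j Fin.≟ α)))
                         (ℚP.*-zeroʳ (f (punchIn α j)))

δ-inverse : ∀ {n} (g : Perm n) γ α → δ (app g γ) α ≡ δ γ (inv g α)
δ-inverse g γ α = indicator-cong (λ gγ≡α → sym (Inverse.inverseʳ g (sym gγ≡α))) (Inverse.inverseˡ g)
  (app g γ Fin.≟ α) (γ Fin.≟ inv g α)

-- For φ = app g this is the paper's u^g (push-perm).
push : ∀ {n} → (Fin n → Fin n) → (Fin n → ℚ) → Fin n → ℚ
push {n} φ u α = ∑[ γ < n ] (u γ ⋆ δ (φ γ) α)

push-perm : ∀ {n} (g : Perm n) u α → push (app g) u α ≡ u (inv g α)
push-perm g u α = trans (sum-cong-≗ (λ γ → cong (u γ ⋆_) (δ-inverse g γ α))) (∑-δ u (inv g α))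

∑-δ-perm : ∀ {n} (g : Perm n) α → ∑[ γ < n ] δ (app g γ) α ≡ 1ℚ
∑-δ-perm g α = trans (sum-cong-≗ (λ γ → sym (ℚP.*-identityˡ (δ (app g γ) α)))) (push-perm g (λ _ → 1ℚ) α)

korb≡∑∑Aorb : ∀ {n} (G : PermGroup n) α β → korb G α β ≡ ∑[ γ < n ] ∑[ ω < n ] Aorb G α β γ ω
korb≡∑∑Aorb G α β = trans (Σℚ≡∑ (λ γ → Σℚ (λ ω → Aorb G α β γ ω ⋆ Aorb G α β γ ω)))
  (sum-cong-≗ (λ γ → trans (Σℚ≡∑ (λ ω → Aorb G α β γ ω ⋆ Aorb G α β γ ω))
                           (sum-cong-≗ (λ ω → indicator-idem (inOrbital? G α β γ ω)))))

module GroupSum {n} (G : PermGroup n) where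

  size : ℕ
  size = length (elems G)

  element : Fin size → Fin n → Fin n
  element i = app (lookup (elems G) i)

  _∈G : (Fin n → Fin n) → Set
  φ ∈G = ∃ λ g → g ∈ elems G × app g ≗ φ

  index-of : ∀ {g} → g ∈ elems G → ∃ λ i → lookup (elems G) i ≡ g
  index-of g∈G = Any.index g∈G , sym (lookup-index g∈G)

  infix 4 _≗?_
  _≗?_ : (φ ψ : Fin n → Fin n) → Dec (φ ≗ ψ)
  φ ≗? ψ = Fin.all? (λ x → φ x Fin.≟ ψ x)

  multiplicity : (Fin n → Fin n) → ℚ
  multiplicity φ = ∑[ j < size ] indicator (element j ≗? φ)

  -- elems G may list an element several times; weighting each entry by 1/multiplicity
  -- makes ∑G F the sum of F over the distinct elements of G.
  weight : Fin size → ℚ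
  weight i = recip (multiplicity (element i))

  ∑G : ((Fin n → Fin n) → ℚ) → ℚ
  ∑G F = ∑[ i < size ] (weight i ⋆ F (element i))

  order : ℚ
  order = ∑G (λ _ → 1ℚ)

  multiplicity-cong : ∀ {φ ψ} → φ ≗ ψ → multiplicity φ ≡ multiplicity ψ
  multiplicity-cong φ≗ψ = sum-cong-≗ (λ j → indicator-cong
    (λ e x → trans (e x) (φ≗ψ x)) (λ e x → trans (e x) (sym (φ≗ψ x))) (element j ≗? _) (element j ≗? _))

  multiplicity≢0 : ∀ {φ} → φ ∈G → multiplicity φ ≢ 0ℚ
  multiplicity≢0 {φ} (g , g∈G , g≗φ) m≡0 with i , refl ← index-of g∈G = ℚP.1≢0 (begin
    1ℚ                             ≡⟨ indicator-yes g≗φ (element i ≗? φ) ⟨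
    indicator (element i ≗? φ)     ≡⟨ ∑-nonNeg-≡0 (λ j → indicator-nonNeg (element j ≗? φ)) m≡0 i ⟩
    0ℚ                             ∎)

  weight-pos : ∀ i → 0ℚ < weight i
  weight-pos i = recip-pos (nonNeg∧≢0⇒pos (∑-nonNeg (λ j → indicator-nonNeg (element j ≗? element i)))
    (multiplicity≢0 (lookup (elems G) i , ∈-lookup i , λ _ → refl)))

  weight≢0 : ∀ i → weight i ≢ 0ℚ
  weight≢0 i w≡0 = ℚP.<-irrefl (sym w≡0) (weight-pos i)

  ∑-indicator-weight : ∀ {φ} → φ ∈G → ∑[ i < size ] (indicator (element i ≗? φ) ⋆ weight i) ≡ 1ℚ
  ∑-indicator-weight {φ} φ∈G = begin
    ∑[ i < size ] (indicator (element i ≗? φ) ⋆ weight i)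
      ≡⟨ sum-cong-≗ (λ i → indicator-*-cong (element i ≗? φ) (cong recip ∘ multiplicity-cong)) ⟩
    ∑[ i < size ] (indicator (element i ≗? φ) ⋆ recip (multiplicity φ))
      ≡⟨ *-distribʳ-sum (recip (multiplicity φ)) (λ i → indicator (element i ≗? φ)) ⟨
    multiplicity φ ⋆ recip (multiplicity φ)
      ≡⟨ recip-inverseʳ (multiplicity≢0 φ∈G) ⟩
    1ℚ ∎

  ∑G-cong : ∀ {F H} → (∀ g → g ∈ elems G → F (app g) ≡ H (app g)) → ∑G F ≡ ∑G H
  ∑G-cong F≡H = sum-cong-≗ (λ i → cong (weight i ⋆_) (F≡H _ (∈-lookup i)))

  ∑G-*ˡ : ∀ c F → ∑G (λ φ → c ⋆ F φ) ≡ c ⋆ ∑G F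
  ∑G-*ˡ c F = trans (sum-cong-≗ (λ i → commuteˡ (weight i) c (F (element i))))
                    (sym (*-distribˡ-sum c (λ i → weight i ⋆ F (element i))))
    where
    commuteˡ : ∀ a b c → a ⋆ (b ⋆ c) ≡ b ⋆ (a ⋆ c)
    commuteˡ = solve-∀ ℚ-ring

  ∑G-const : ∀ c → ∑G (λ _ → c) ≡ c ⋆ order
  ∑G-const c = trans (∑G-cong (λ _ _ → sym (ℚP.*-identityʳ c))) (∑G-*ˡ c (λ _ → 1ℚ))

  ∑G-+ : ∀ F H → ∑G (λ φ → F φ + H φ) ≡ ∑G F + ∑G H
  ∑G-+ F H = trans (sum-cong-≗ (λ i → ℚP.*-distribˡ-+ (weight i) (F (element i)) (H (element i))))
                   (∑-distrib-+ (λ i → weight i ⋆ F (element i)) (λ i → weight i ⋆ H (element i)))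

  ∑G-∑ : ∀ {m} (F : Fin m → (Fin n → Fin n) → ℚ) →
         ∑G (λ φ → ∑[ k < m ] F k φ) ≡ ∑[ k < m ] ∑G (F k)
  ∑G-∑ F = trans (sum-cong-≗ (λ i → *-distribˡ-sum (weight i) (λ k → F k (element i))))
                 (∑-comm (λ i k → weight i ⋆ F k (element i)))

  ∑G-∑∑ : ∀ {l m} (F : Fin l → Fin m → (Fin n → Fin n) → ℚ) →
          ∑G (λ φ → ∑[ i < l ] ∑[ j < m ] F i j φ) ≡ ∑[ i < l ] ∑[ j < m ] ∑G (F i j)
  ∑G-∑∑ {m = m} F = trans (∑G-∑ (λ i φ → ∑[ j < m ] F i j φ)) (sum-cong-≗ (λ i → ∑G-∑ (F i)))

  ∑G-bilinear : ∀ {l m} (a : Fin l → ℚ) (b : Fin m → ℚ)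
                (P : Fin l → (Fin n → Fin n) → ℚ) (R : Fin m → (Fin n → Fin n) → ℚ) →
    ∑G (λ φ → ∑[ i < l ] (a i ⋆ P i φ) ⋆ ∑[ j < m ] (b j ⋆ R j φ))
      ≡ ∑[ i < l ] ∑[ j < m ] (a i ⋆ b j ⋆ ∑G (λ φ → P i φ ⋆ R j φ))
  ∑G-bilinear {l} {m} a b P R = begin
    ∑G (λ φ → ∑[ i < l ] (a i ⋆ P i φ) ⋆ ∑[ j < m ] (b j ⋆ R j φ))
      ≡⟨ ∑G-cong (λ g _ → trans (∑-*-∑ (λ i → a i ⋆ P i (app g)) (λ j → b j ⋆ R j (app g)))
                                (sum-cong-≗ (λ i → sum-cong-≗ (λ j →
                                   interchange (a i) (P i (app g)) (b j) (R j (app g)))))) ⟩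
    ∑G (λ φ → ∑[ i < l ] ∑[ j < m ] (a i ⋆ b j ⋆ (P i φ ⋆ R j φ)))
      ≡⟨ ∑G-∑∑ (λ i j φ → a i ⋆ b j ⋆ (P i φ ⋆ R j φ)) ⟩
    ∑[ i < l ] ∑[ j < m ] ∑G (λ φ → a i ⋆ b j ⋆ (P i φ ⋆ R j φ))
      ≡⟨ sum-cong-≗ (λ i → sum-cong-≗ (λ j → ∑G-*ˡ (a i ⋆ b j) (λ φ → P i φ ⋆ R j φ))) ⟩
    ∑[ i < l ] ∑[ j < m ] (a i ⋆ b j ⋆ ∑G (λ φ → P i φ ⋆ R j φ)) ∎
    where
    interchange : ∀ a p b r → a ⋆ p ⋆ (b ⋆ r) ≡ a ⋆ b ⋆ (p ⋆ r)
    interchange = solve-∀ ℚ-ring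

  ∑G-nonNeg-≡0 : ∀ {F} → (∀ φ → 0ℚ ≤ F φ) → ∑G F ≡ 0ℚ → ∀ g → g ∈ elems G → F (app g) ≡ 0ℚ
  ∑G-nonNeg-≡0 {F} F≥0 ∑F≡0 g g∈G with i , refl ← index-of g∈G =
    [ (λ wᵢ≡0 → contradiction wᵢ≡0 (weight≢0 i)) , id ]′
      (a*b≡0⇒a≡0∨b≡0 (∑-nonNeg-≡0 terms≥0 ∑F≡0 i))
    where
    terms≥0 : ∀ i → 0ℚ ≤ weight i ⋆ F (element i)
    terms≥0 i = *-nonNeg (ℚP.<⇒≤ (weight-pos i)) (F≥0 (element i))

  order≢0 : order ≢ 0ℚ
  order≢0 order≡0 with e , e∈G , _ ← has-id G =
    ℚP.1≢0 (∑G-nonNeg-≡0 (λ _ → ℚP.nonNegative⁻¹ 1ℚ) order≡0 e e∈G)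

  ∘inv-∈G : ∀ {g h} → g ∈ elems G → h ∈ elems G → (app g ∘ inv h) ∈G
  ∘inv-∈G {g} g∈G h∈G =
    let h⁻¹ , h⁻¹∈G , h⁻¹≗inv = has-inv G h∈G
        k , k∈G , k≗g∘h⁻¹ = has-∘ G g∈G h⁻¹∈G
    in k , k∈G , λ x → trans (k≗g∘h⁻¹ x) (cong (app g) (h⁻¹≗inv x))

  ∑-indicator-weight-* : ∀ {F} → Congruent _≗_ _≡_ F → ∀ {φ} → φ ∈G →
    ∑[ j < size ] (indicator (element j ≗? φ) ⋆ (weight j ⋆ F (element j))) ≡ F φ
  ∑-indicator-weight-* {F} F-cong {φ} φ∈G = begin
    ∑[ j < size ] (indicator (element j ≗? φ) ⋆ (weight j ⋆ F (element j)))
      ≡⟨ sum-cong-≗ (λ j → indicator-*-cong (element j ≗? φ) (cong (weight j ⋆_) ∘ F-cong)) ⟩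
    ∑[ j < size ] (indicator (element j ≗? φ) ⋆ (weight j ⋆ F φ))
      ≡⟨ sum-cong-≗ (λ j → ℚP.*-assoc (indicator (element j ≗? φ)) (weight j) (F φ)) ⟨
    ∑[ j < size ] (indicator (element j ≗? φ) ⋆ weight j ⋆ F φ)
      ≡⟨ *-distribʳ-sum (F φ) (λ j → indicator (element j ≗? φ) ⋆ weight j) ⟨
    ∑[ j < size ] (indicator (element j ≗? φ) ⋆ weight j) ⋆ F φ
      ≡⟨ cong (_⋆ F φ) (∑-indicator-weight φ∈G) ⟩
    1ℚ ⋆ F φ
      ≡⟨ ℚP.*-identityˡ (F φ) ⟩
    F φ ∎

  -- Expand F (gᵢ ∘ h) over the entries gⱼ equal to it, swap the two sums and recollect
  -- with gⱼ ≗ gᵢ ∘ h ⇔ gᵢ ≗ gⱼ ∘ h⁻¹.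
  ∑G-invariant : ∀ {h F} → h ∈ elems G → Congruent _≗_ _≡_ F → ∑G (λ φ → F (φ ∘ app h)) ≡ ∑G F
  ∑G-invariant {h} {F} h∈G F-cong = begin
    ∑[ i < size ] (weight i ⋆ F (element i ∘ app h))
      ≡⟨ sum-cong-≗ (λ i → cong (weight i ⋆_)
                                (sym (∑-indicator-weight-* F-cong (has-∘ G (∈-lookup i) h∈G)))) ⟩
    ∑[ i < size ] (weight i ⋆ ∑[ j < size ] (forward i j ⋆ wF j))
      ≡⟨ sum-cong-≗ (λ i → *-distribˡ-sum (weight i) (λ j → forward i j ⋆ wF j)) ⟩
    ∑[ i < size ] ∑[ j < size ] (weight i ⋆ (forward i j ⋆ wF j))
      ≡⟨ ∑-comm (λ i j → weight i ⋆ (forward i j ⋆ wF j)) ⟩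
    ∑[ j < size ] ∑[ i < size ] (weight i ⋆ (forward i j ⋆ wF j))
      ≡⟨ sum-cong-≗ (λ j → sum-cong-≗ (λ i → regroup i j)) ⟩
    ∑[ j < size ] ∑[ i < size ] (wF j ⋆ (backward j i ⋆ weight i))
      ≡⟨ sum-cong-≗ (λ j → *-distribˡ-sum (wF j) (λ i → backward j i ⋆ weight i)) ⟨
    ∑[ j < size ] (wF j ⋆ ∑[ i < size ] (backward j i ⋆ weight i))
      ≡⟨ sum-cong-≗ (λ j → cong (wF j ⋆_) (∑-indicator-weight (∘inv-∈G (∈-lookup j) h∈G))) ⟩
    ∑[ j < size ] (wF j ⋆ 1ℚ)
      ≡⟨ sum-cong-≗ (λ j → ℚP.*-identityʳ (wF j)) ⟩
    ∑G F ∎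
    where
    wF : Fin size → ℚ
    wF j = weight j ⋆ F (element j)
    forward : Fin size → Fin size → ℚ
    forward i j = indicator (element j ≗? element i ∘ app h)
    backward : Fin size → Fin size → ℚ
    backward j i = indicator (element i ≗? element j ∘ inv h)
    translate : ∀ {φ ψ} → ψ ≗ φ ∘ app h → φ ≗ ψ ∘ inv h
    translate {φ} {ψ} ψ≗φh y = trans (cong φ (sym (Inverse.strictlyInverseˡ h y))) (sym (ψ≗φh (inv h y)))
    untranslate : ∀ {φ ψ} → φ ≗ ψ ∘ inv h → ψ ≗ φ ∘ app h
    untranslate {φ} {ψ} φ≗ψh⁻¹ x = trans (cong ψ (sym (Inverse.strictlyInverseʳ h x))) (sym (φ≗ψh⁻¹ (app h x)))
    rotate : ∀ a b c → a ⋆ (b ⋆ c) ≡ c ⋆ (b ⋆ a)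
    rotate = solve-∀ ℚ-ring
    regroup : ∀ i j → weight i ⋆ (forward i j ⋆ wF j) ≡ wF j ⋆ (backward j i ⋆ weight i)
    regroup i j = trans (rotate (weight i) (forward i j) (wF j))
      (cong (λ t → wF j ⋆ (t ⋆ weight i))
            (indicator-cong translate untranslate (element j ≗? element i ∘ app h) (element i ≗? element j ∘ inv h)))

  ∑G-squared-deviation : ∀ F c →
    ∑G (λ φ → (F φ - c) ⋆ (F φ - c)) ≡ ∑G (λ φ → F φ ⋆ F φ) + (- (c + c)) ⋆ ∑G F + c ⋆ c ⋆ order
  ∑G-squared-deviation F c = begin
    ∑G (λ φ → (F φ - c) ⋆ (F φ - c))
      ≡⟨ ∑G-cong (λ g _ → expand (F (app g)) c) ⟩
    ∑G (λ φ → F φ ⋆ F φ + (- (c + c)) ⋆ F φ + c ⋆ c)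
      ≡⟨ ∑G-+ (λ φ → F φ ⋆ F φ + (- (c + c)) ⋆ F φ) (λ _ → c ⋆ c) ⟩
    ∑G (λ φ → F φ ⋆ F φ + (- (c + c)) ⋆ F φ) + ∑G (λ _ → c ⋆ c)
      ≡⟨ cong₂ _+_ (trans (∑G-+ (λ φ → F φ ⋆ F φ) (λ φ → (- (c + c)) ⋆ F φ))
                          (cong (∑G (λ φ → F φ ⋆ F φ) +_) (∑G-*ˡ (- (c + c)) F)))
                   (∑G-const (c ⋆ c)) ⟩
    ∑G (λ φ → F φ ⋆ F φ) + (- (c + c)) ⋆ ∑G F + c ⋆ c ⋆ order ∎
    where
    expand : ∀ x c → (x - c) ⋆ (x - c) ≡ x ⋆ x + (- (c + c)) ⋆ x + c ⋆ c
    expand = solve-∀ ℚ-ring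

module Orbits {n} (G : PermGroup n) where
  open GroupSum G

  count₁ : Fin n → Fin n → ℚ
  count₁ γ α = ∑G (λ φ → δ (φ γ) α)

  count₁-transitive : Transitive G → ℕ→ℚ n ≢ 0ℚ → ∀ γ α → count₁ γ α ≡ recip (ℕ→ℚ n) ⋆ order
  count₁-transitive transitive n≢0 γ α = trans (independent γ) (a*x≡b⇒x≡recip[a]*b n≢0 total)
    where
    independent : ∀ γ → count₁ γ α ≡ count₁ α α
    independent γ with h , h∈G , hα≡γ ← transitive α γ =
      trans (cong (λ x → ∑G (λ φ → δ (φ x) α)) (sym hα≡γ))
            (∑G-invariant h∈G (λ φ≗ψ → cong (λ x → δ x α) (φ≗ψ α)))
    total : ℕ→ℚ n ⋆ count₁ α α ≡ order
    total = begin
      ℕ→ℚ n ⋆ count₁ α α               ≡⟨ ∑-const n (count₁ α α) ⟨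
      ∑[ γ < n ] count₁ α α            ≡⟨ sum-cong-≗ independent ⟨
      ∑[ γ < n ] count₁ γ α            ≡⟨ ∑G-∑ (λ γ φ → δ (φ γ) α) ⟨
      ∑G (λ φ → ∑[ γ < n ] δ (φ γ) α)  ≡⟨ ∑G-cong (λ g _ → ∑-δ-perm g α) ⟩
      order                            ∎

  count₂ : (γ ω α β : Fin n) → ℚ
  count₂ γ ω α β = ∑G (λ φ → δ (φ γ) α ⋆ δ (φ ω) β)

  count₂-orbital : ∀ α β γ ω → count₂ γ ω α β ≡ count₂ α β α β ⋆ Aorb G α β γ ω
  count₂-orbital α β γ ω with inOrbital? G α β γ ω
  ... | yes sent with h , h∈G , hα≡γ , hβ≡ω ← find sent =
    trans (cong₂ (λ x y → ∑G (λ φ → δ (φ x) α ⋆ δ (φ y) β)) (sym hα≡γ) (sym hβ≡ω))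
          (trans (∑G-invariant h∈G (λ φ≗ψ → cong₂ (λ x y → δ x α ⋆ δ y β) (φ≗ψ α) (φ≗ψ β)))
                 (sym (ℚP.*-identityʳ _)))
  ... | no ¬sent = begin
    count₂ γ ω α β            ≡⟨ ∑G-cong vanishes ⟩
    ∑G (λ _ → 0ℚ)             ≡⟨ ∑G-const 0ℚ ⟩
    0ℚ ⋆ order                ≡⟨ ℚP.*-zeroˡ order ⟩
    0ℚ                        ≡⟨ ℚP.*-zeroʳ (count₂ α β α β) ⟨
    count₂ α β α β ⋆ 0ℚ       ∎
    where
    vanishes : ∀ g → g ∈ elems G → δ (app g γ) α ⋆ δ (app g ω) β ≡ 0ℚ
    vanishes g g∈G with app g γ Fin.≟ α | app g ω Fin.≟ β
    ... | no _      | gω≟β      = ℚP.*-zeroˡ (indicator gω≟β)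
    ... | yes _     | no _      = refl
    ... | yes gγ≡α  | yes gω≡β  with g⁻¹ , g⁻¹∈G , g⁻¹≗inv ← has-inv G g∈G =
      contradiction (lose g⁻¹∈G (undo gγ≡α , undo gω≡β)) ¬sent
      where
      undo : ∀ {x y} → app g x ≡ y → app g⁻¹ y ≡ x
      undo {x} refl = trans (g⁻¹≗inv (app g x)) (Inverse.strictlyInverseʳ g x)

  ∑∑-count₂ : ∀ α β → ∑[ γ < n ] ∑[ ω < n ] count₂ γ ω α β ≡ order
  ∑∑-count₂ α β = begin
    ∑[ γ < n ] ∑[ ω < n ] count₂ γ ω α β
      ≡⟨ ∑G-∑∑ (λ γ ω φ → δ (φ γ) α ⋆ δ (φ ω) β) ⟨
    ∑G (λ φ → ∑[ γ < n ] ∑[ ω < n ] (δ (φ γ) α ⋆ δ (φ ω) β))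
      ≡⟨ ∑G-cong (λ g _ → trans (sym (∑-*-∑ (λ γ → δ (app g γ) α) (λ ω → δ (app g ω) β)))
                                (cong₂ _⋆_ (∑-δ-perm g α) (∑-δ-perm g β))) ⟩
    order ∎

  count₂-value : ∀ α β γ ω → count₂ γ ω α β ≡ recip (korb G α β) ⋆ order ⋆ Aorb G α β γ ω
  count₂-value α β γ ω =
    trans (count₂-orbital α β γ ω) (cong (_⋆ Aorb G α β γ ω) (a*x≡b⇒x≡recip[a]*b k≢0 k·stab≡order))
    where
    stab : ℚ
    stab = count₂ α β α β
    -- orbit–stabiliser: k · |stabiliser of (α, β)| = |G|
    k·stab≡order : korb G α β ⋆ stab ≡ order
    k·stab≡order = begin
      korb G α β ⋆ stab
        ≡⟨ cong (_⋆ stab) (korb≡∑∑Aorb G α β) ⟩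
      (∑[ γ < n ] ∑[ ω < n ] Aorb G α β γ ω) ⋆ stab
        ≡⟨ *-distribʳ-sum stab (λ γ → ∑[ ω < n ] Aorb G α β γ ω) ⟩
      ∑[ γ < n ] ((∑[ ω < n ] Aorb G α β γ ω) ⋆ stab)
        ≡⟨ sum-cong-≗ (λ γ → *-distribʳ-sum stab (Aorb G α β γ)) ⟩
      ∑[ γ < n ] ∑[ ω < n ] (Aorb G α β γ ω ⋆ stab)
        ≡⟨ sum-cong-≗ (λ γ → sum-cong-≗ (λ ω →
             trans (ℚP.*-comm _ stab) (sym (count₂-orbital α β γ ω)))) ⟩
      ∑[ γ < n ] ∑[ ω < n ] count₂ γ ω α β
        ≡⟨ ∑∑-count₂ α β ⟩
      order ∎
    k≢0 : korb G α β ≢ 0ℚ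
    k≢0 k≡0 = order≢0 (trans (sym k·stab≡order) (trans (cong (_⋆ stab) k≡0) (ℚP.*-zeroˡ stab)))

  ∑G-push : Transitive G → ℕ→ℚ n ≢ 0ℚ → ∀ u α →
            ∑G (λ φ → push φ u α) ≡ order ⋆ (recip (ℕ→ℚ n) ⋆ ∑[ γ < n ] u γ)
  ∑G-push transitive n≢0 u α = begin
    ∑G (λ φ → push φ u α)
      ≡⟨ ∑G-∑ (λ γ φ → u γ ⋆ δ (φ γ) α) ⟩
    ∑[ γ < n ] ∑G (λ φ → u γ ⋆ δ (φ γ) α)
      ≡⟨ sum-cong-≗ (λ γ → trans (∑G-*ˡ (u γ) (λ φ → δ (φ γ) α))
                                 (cong (u γ ⋆_) (count₁-transitive transitive n≢0 γ α))) ⟩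
    ∑[ γ < n ] (u γ ⋆ (recip (ℕ→ℚ n) ⋆ order))
      ≡⟨ *-distribʳ-sum (recip (ℕ→ℚ n) ⋆ order) u ⟨
    (∑[ γ < n ] u γ) ⋆ (recip (ℕ→ℚ n) ⋆ order)
      ≡⟨ rearrange (∑[ γ < n ] u γ) (recip (ℕ→ℚ n)) order ⟩
    order ⋆ (recip (ℕ→ℚ n) ⋆ ∑[ γ < n ] u γ) ∎
    where
    rearrange : ∀ s r o → s ⋆ (r ⋆ o) ≡ o ⋆ (r ⋆ s)
    rearrange = solve-∀ ℚ-ring

  ∑G-push-push : ∀ u α β → ∑G (λ φ → push φ u α ⋆ push φ u β) ≡ order ⋆ D G u α β
  ∑G-push-push u α β = begin
    ∑G (λ φ → push φ u α ⋆ push φ u β)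
      ≡⟨ ∑G-bilinear u u (λ γ φ → δ (φ γ) α) (λ ω φ → δ (φ ω) β) ⟩
    ∑[ γ < n ] ∑[ ω < n ] (u γ ⋆ u ω ⋆ count₂ γ ω α β)
      ≡⟨ sum-cong-≗ (λ γ → sum-cong-≗ (λ ω → trans (cong (u γ ⋆ u ω ⋆_) (count₂-value α β γ ω))
                                                    (rearrange (u γ) (u ω) c (A γ ω)))) ⟩
    ∑[ γ < n ] ∑[ ω < n ] (c ⋆ (u γ ⋆ A γ ω ⋆ u ω))
      ≡⟨ *-distribˡ-∑∑ c (λ γ ω → u γ ⋆ A γ ω ⋆ u ω) ⟨
    c ⋆ ∑[ γ < n ] ∑[ ω < n ] (u γ ⋆ A γ ω ⋆ u ω)
      ≡⟨ cong (c ⋆_) (trans (sym (form≡∑∑ u A u)) (sym (form-transpose u A))) ⟩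
    recip (korb G α β) ⋆ order ⋆ form u (transpose A) u
      ≡⟨ commuteˡ (recip (korb G α β)) order (form u (transpose A) u) ⟩
    order ⋆ D G u α β ∎
    where
    A : Fin n → Fin n → ℚ
    A = Aorb G α β
    c : ℚ
    c = recip (korb G α β) ⋆ order
    rearrange : ∀ x y c a → x ⋆ y ⋆ (c ⋆ a) ≡ c ⋆ (x ⋆ a ⋆ y)
    rearrange = solve-∀ ℚ-ring
    commuteˡ : ∀ r o s → r ⋆ o ⋆ s ≡ o ⋆ (r ⋆ s)
    commuteˡ = solve-∀ ℚ-ring

module Intersection {n} (G : PermGroup n) (u v : Fin n → ℚ) where
  open GroupSum G
  open Orbits G

  intersection : (Fin n → Fin n) → ℚ
  intersection φ = ∑[ α < n ] (v α ⋆ push φ u α)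

  intersection-perm : ∀ g → intersection (app g) ≡ v · (u ∘ inv g)
  intersection-perm g = trans (sum-cong-≗ (λ α → cong (v α ⋆_) (push-perm g u α))) (sym (·≡∑ v (u ∘ inv g)))

  mean : ℚ
  mean = recip (ℕ→ℚ n) ⋆ (u · 𝟙) ⋆ (v · 𝟙)

  ∑G-intersection : Transitive G → ℕ→ℚ n ≢ 0ℚ → ∑G intersection ≡ order ⋆ mean
  ∑G-intersection transitive n≢0 = begin
    ∑G intersection
      ≡⟨ ∑G-∑ (λ α φ → v α ⋆ push φ u α) ⟩
    ∑[ α < n ] ∑G (λ φ → v α ⋆ push φ u α)
      ≡⟨ sum-cong-≗ (λ α → trans (∑G-*ˡ (v α) (λ φ → push φ u α))
                                 (cong (v α ⋆_) (∑G-push transitive n≢0 u α))) ⟩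
    ∑[ α < n ] (v α ⋆ (order ⋆ (r ⋆ ∑[ γ < n ] u γ)))
      ≡⟨ *-distribʳ-sum (order ⋆ (r ⋆ ∑[ γ < n ] u γ)) v ⟨
    (∑[ α < n ] v α) ⋆ (order ⋆ (r ⋆ ∑[ γ < n ] u γ))
      ≡⟨ rearrange (∑[ α < n ] v α) order r (∑[ γ < n ] u γ) ⟩
    order ⋆ (r ⋆ ∑[ γ < n ] u γ ⋆ ∑[ α < n ] v α)
      ≡⟨ cong₂ (λ U V → order ⋆ (r ⋆ U ⋆ V)) (·𝟙≡∑ u) (·𝟙≡∑ v) ⟨
    order ⋆ mean ∎
    where
    r : ℚ
    r = recip (ℕ→ℚ n)
    rearrange : ∀ V o r U → V ⋆ (o ⋆ (r ⋆ U)) ≡ o ⋆ (r ⋆ U ⋆ V)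
    rearrange = solve-∀ ℚ-ring

  ∑G-intersection² : ∑G (λ φ → intersection φ ⋆ intersection φ) ≡ order ⋆ form v (D G u) v
  ∑G-intersection² = begin
    ∑G (λ φ → intersection φ ⋆ intersection φ)
      ≡⟨ ∑G-bilinear v v (λ α φ → push φ u α) (λ β φ → push φ u β) ⟩
    ∑[ α < n ] ∑[ β < n ] (v α ⋆ v β ⋆ ∑G (λ φ → push φ u α ⋆ push φ u β))
      ≡⟨ sum-cong-≗ (λ α → sum-cong-≗ (λ β → trans (cong (v α ⋆ v β ⋆_) (∑G-push-push u α β))
                                                    (rearrange (v α) (v β) order (D G u α β)))) ⟩
    ∑[ α < n ] ∑[ β < n ] (order ⋆ (v α ⋆ D G u α β ⋆ v β))
      ≡⟨ *-distribˡ-∑∑ order (λ α β → v α ⋆ D G u α β ⋆ v β) ⟨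
    order ⋆ ∑[ α < n ] ∑[ β < n ] (v α ⋆ D G u α β ⋆ v β)
      ≡⟨ cong (order ⋆_) (form≡∑∑ v (D G u) v) ⟨
    order ⋆ form v (D G u) v ∎
    where
    rearrange : ∀ x y o d → x ⋆ y ⋆ (o ⋆ d) ≡ o ⋆ (x ⋆ d ⋆ y)
    rearrange = solve-∀ ℚ-ring

  constant-intersection≡mean : Transitive G → ℕ→ℚ n ≢ 0ℚ →
    ∀ {c} → (∀ g → g ∈ elems G → intersection (app g) ≡ c) → c ≡ mean
  constant-intersection≡mean transitive n≢0 {c} intersection≡c = *-cancelˡ-≡ order≢0 (begin
    order ⋆ c        ≡⟨ ℚP.*-comm order c ⟩
    c ⋆ order        ≡⟨ ∑G-const c ⟨
    ∑G (λ _ → c)     ≡⟨ ∑G-cong intersection≡c ⟨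
    ∑G intersection  ≡⟨ ∑G-intersection transitive n≢0 ⟩
    order ⋆ mean     ∎)

  intersection≡mean⇒form≡mean² : (∀ g → g ∈ elems G → intersection (app g) ≡ mean) →
                                 form v (D G u) v ≡ mean ⋆ mean
  intersection≡mean⇒form≡mean² intersection≡mean = *-cancelˡ-≡ order≢0 (begin
    order ⋆ form v (D G u) v
      ≡⟨ ∑G-intersection² ⟨
    ∑G (λ φ → intersection φ ⋆ intersection φ)
      ≡⟨ ∑G-cong (λ g g∈G → cong₂ _⋆_ (intersection≡mean g g∈G) (intersection≡mean g g∈G)) ⟩
    ∑G (λ _ → mean ⋆ mean)
      ≡⟨ ∑G-const (mean ⋆ mean) ⟩
    mean ⋆ mean ⋆ order
      ≡⟨ ℚP.*-comm (mean ⋆ mean) order ⟩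
    order ⋆ (mean ⋆ mean) ∎)

  form≡mean²⇒intersection≡mean : Transitive G → ℕ→ℚ n ≢ 0ℚ →
    form v (D G u) v ≡ mean ⋆ mean → ∀ g → g ∈ elems G → intersection (app g) ≡ mean
  form≡mean²⇒intersection≡mean transitive n≢0 form≡mean² g g∈G =
    x∙y⁻¹≈ε⇒x≈y (intersection (app g)) mean
      (x*x≡0⇒x≡0 (∑G-nonNeg-≡0 (λ φ → x*x-nonNeg (intersection φ - mean)) variance≡0 g g∈G))
    where
    variance≡0 : ∑G (λ φ → (intersection φ - mean) ⋆ (intersection φ - mean)) ≡ 0ℚ
    variance≡0 = begin
      ∑G (λ φ → (intersection φ - mean) ⋆ (intersection φ - mean))
        ≡⟨ ∑G-squared-deviation intersection mean ⟩
      ∑G (λ φ → intersection φ ⋆ intersection φ) + (- (mean + mean)) ⋆ ∑G intersection + mean ⋆ mean ⋆ order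
        ≡⟨ cong₂ (λ s t → s + (- (mean + mean)) ⋆ t + mean ⋆ mean ⋆ order)
                 ∑G-intersection² (∑G-intersection transitive n≢0) ⟩
      order ⋆ form v (D G u) v + (- (mean + mean)) ⋆ (order ⋆ mean) + mean ⋆ mean ⋆ order
        ≡⟨ cong (λ q → order ⋆ q + (- (mean + mean)) ⋆ (order ⋆ mean) + mean ⋆ mean ⋆ order) form≡mean² ⟩
      order ⋆ (mean ⋆ mean) + (- (mean + mean)) ⋆ (order ⋆ mean) + mean ⋆ mean ⋆ order
        ≡⟨ cancels order mean ⟩
      0ℚ ∎
      where
      cancels : ∀ o m → o ⋆ (m ⋆ m) + (- (m + m)) ⋆ (o ⋆ m) + m ⋆ m ⋆ o ≡ 0ℚ
      cancels = solve-∀ ℚ-ring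

  mean≢0 : ℕ→ℚ n ≢ 0ℚ → NontrivialℚVec n u → NontrivialℚVec n v → mean ≢ 0ℚ
  mean≢0 n≢0 u-nontrivial v-nontrivial =
    x#0y#0→xy#0 (x#0y#0→xy#0 (recip≢0 n≢0) (nontrivial⇒·𝟙≢0 u-nontrivial)) (nontrivial⇒·𝟙≢0 v-nontrivial)

  n⁻²U²V²≡mean² : ℕ→ℚ n ≢ 0ℚ →
    recip (ℕ→ℚ (n * n)) ⋆ ((u · 𝟙) ⋆ (u · 𝟙)) ⋆ ((v · 𝟙) ⋆ (v · 𝟙)) ≡ mean ⋆ mean
  n⁻²U²V²≡mean² n≢0 = begin
    recip (ℕ→ℚ (n * n)) ⋆ (U ⋆ U) ⋆ (V ⋆ V)
      ≡⟨ cong (λ q → recip q ⋆ (U ⋆ U) ⋆ (V ⋆ V)) (ℕ→ℚ-homo-* n n) ⟩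
    recip (ℕ→ℚ n ⋆ ℕ→ℚ n) ⋆ (U ⋆ U) ⋆ (V ⋆ V)
      ≡⟨ cong (λ r → r ⋆ (U ⋆ U) ⋆ (V ⋆ V)) (recip-* n≢0 n≢0) ⟩
    recip (ℕ→ℚ n) ⋆ recip (ℕ→ℚ n) ⋆ (U ⋆ U) ⋆ (V ⋆ V)
      ≡⟨ square (recip (ℕ→ℚ n)) U V ⟩
    mean ⋆ mean ∎
    where
    U V : ℚ
    U = u · 𝟙
    V = v · 𝟙
    square : ∀ r U V → r ⋆ r ⋆ (U ⋆ U) ⋆ (V ⋆ V) ≡ r ⋆ U ⋆ V ⋆ (r ⋆ U ⋆ V)
    square = solve-∀ ℚ-ring

  intersection-ℕ : ∀ (a b : Fin n → ℕ) → (∀ ω → u ω ≡ ℕ→ℚ (b ω)) → (∀ ω → v ω ≡ ℕ→ℚ (a ω)) →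
                   ∀ g → intersection (app g) ≡ ℕ→ℚ (dotℕ a (b ∘ inv g))
  intersection-ℕ a b u≗b v≗a g = begin
    intersection (app g)
      ≡⟨ intersection-perm g ⟩
    v · (u ∘ inv g)
      ≡⟨ ·≡∑ v (u ∘ inv g) ⟩
    ∑[ ω < n ] (v ω ⋆ u (inv g ω))
      ≡⟨ sum-cong-≗ (λ ω → cong₂ _⋆_ (v≗a ω) (u≗b (inv g ω))) ⟩
    ∑[ ω < n ] (ℕ→ℚ (a ω) ⋆ ℕ→ℚ (b (inv g ω)))
      ≡⟨ sum-cong-≗ (λ ω → ℕ→ℚ-homo-* (a ω) (b (inv g ω))) ⟨
    ∑[ ω < n ] ℕ→ℚ (a ω * b (inv g ω))
      ≡⟨ ℕ→ℚ-Σℕ (λ ω → a ω * b (inv g ω)) ⟨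
    ℕ→ℚ (dotℕ a (b ∘ inv g)) ∎

-- Nonspreading

NonspreadingCertificate : ∀ {n} → PermGroup n → Set
NonspreadingCertificate {n} G =
  Σ (Fin n → ℚ) λ u → Σ (Fin n → ℚ) λ v →
    NontrivialℚVec n u × NontrivialℚVec n v ×
    (∀ ω → u ω ≡ 0ℚ ⊎ u ω ≡ 1ℚ) ×
    (∀ ω → ∃ λ m → v ω ≡ ℕ→ℚ m) ×
    (∃ λ m → (v · 𝟙) ≡ ℕ→ℚ m × m ∣ n) ×
    (form v (D G u) v ≡ recip (ℕ→ℚ (n * n)) ℚ.* ((u · 𝟙) ℚ.* (u · 𝟙)) ℚ.* ((v · 𝟙) ℚ.* (v · 𝟙)))

nonspreading⇒certificate : ∀ {n} (G : PermGroup n) → Transitive G → Nonspreading G → NonspreadingCertificate G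
nonspreading⇒certificate {n} G transitive (χA , B , λ′ , A-nontrivial , B-nontrivial , _ , |A|∣n , constant) =
  u , v , Equivalence.from (nontrivial-ℕ→ℚ (λ _ → refl)) B-nontrivial ,
  Equivalence.from (nontrivial-ℕ→ℚ (λ _ → refl)) A-nontrivial ,
  (λ ω → χBool-01 (B ω)) , (λ ω → χA ω , refl) ,
  (Σℕ χA , ·𝟙≡ℕ→ℚ-Σℕ {a = χA} (λ _ → refl) , |A|∣n) ,
  trans (intersection≡mean⇒form≡mean² intersection≡mean) (sym (n⁻²U²V²≡mean² n≢0))
  where
  u v : Fin n → ℚ
  u ω = ℕ→ℚ (χBool (B ω))
  v ω = ℕ→ℚ (χA ω)
  open Intersection G u v
  n≢0 : ℕ→ℚ n ≢ 0ℚ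
  n≢0 = Fin⇒ℕ→ℚ≢0 (proj₁ (proj₁ A-nontrivial))
  intersection≡λ′ : ∀ g → g ∈ elems G → intersection (app g) ≡ ℕ→ℚ λ′
  intersection≡λ′ g g∈G =
    trans (intersection-ℕ χA (χBool ∘ B) (λ _ → refl) (λ _ → refl) g) (cong ℕ→ℚ (constant g g∈G))
  intersection≡mean : ∀ g → g ∈ elems G → intersection (app g) ≡ mean
  intersection≡mean g g∈G =
    trans (intersection≡λ′ g g∈G) (constant-intersection≡mean transitive n≢0 intersection≡λ′)

certificate⇒nonspreading : ∀ {n} (G : PermGroup n) → Transitive G → NonspreadingCertificate G → Nonspreading G
certificate⇒nonspreading {n} G transitive
  (u , v , u-nontrivial , v-nontrivial , u∈01 , v∈ℕ , (m , v·𝟙≡m , m∣n) , form≡) =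
  χA , B , λ′ ,
  Equivalence.to (nontrivial-ℕ→ℚ v≗χA) v-nontrivial , Equivalence.to (nontrivial-ℕ→ℚ u≗χB) u-nontrivial ,
  ℕP.n≢0⇒n>0 λ′≢0 , subst (_∣ n) (sym |A|≡m) m∣n ,
  λ g g∈G → ℕ→ℚ-injective (trans (dot≡intersection g) (intersection≡λ′ g g∈G))
  where
  χA : Fin n → ℕ
  χA ω = proj₁ (v∈ℕ ω)
  v≗χA : ∀ ω → v ω ≡ ℕ→ℚ (χA ω)
  v≗χA ω = proj₂ (v∈ℕ ω)
  B : Fin n → Bool
  B ω = proj₁ (01⇒χBool (u∈01 ω))
  u≗χB : ∀ ω → u ω ≡ ℕ→ℚ (χBool (B ω))
  u≗χB ω = proj₂ (01⇒χBool (u∈01 ω))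
  n≢0 : ℕ→ℚ n ≢ 0ℚ
  n≢0 = Fin⇒ℕ→ℚ≢0 (proj₁ (proj₁ (proj₂ u-nontrivial)))
  open Intersection G u v
  intersection≡mean : ∀ g → g ∈ elems G → intersection (app g) ≡ mean
  intersection≡mean = form≡mean²⇒intersection≡mean transitive n≢0 (trans form≡ (n⁻²U²V²≡mean² n≢0))
  dot≡intersection : ∀ g → ℕ→ℚ (dotℕ χA (λ ω → χBool (B (inv g ω)))) ≡ intersection (app g)
  dot≡intersection g = sym (intersection-ℕ χA (χBool ∘ B) u≗χB v≗χA g)
  e : Perm n
  e = proj₁ (has-id G)
  λ′ : ℕ
  λ′ = dotℕ χA (λ ω → χBool (B (inv e ω)))
  λ′≡mean : ℕ→ℚ λ′ ≡ mean
  λ′≡mean = trans (dot≡intersection e) (intersection≡mean e (proj₁ (proj₂ (has-id G))))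
  intersection≡λ′ : ∀ g → g ∈ elems G → intersection (app g) ≡ ℕ→ℚ λ′
  intersection≡λ′ g g∈G = trans (intersection≡mean g g∈G) (sym λ′≡mean)
  λ′≢0 : λ′ ≢ 0
  λ′≢0 λ′≡0 = mean≢0 n≢0 u-nontrivial v-nontrivial (trans (sym λ′≡mean) (cong ℕ→ℚ λ′≡0))
  |A|≡m : Σℕ χA ≡ m
  |A|≡m = ℕ→ℚ-injective (trans (sym (·𝟙≡ℕ→ℚ-Σℕ v≗χA)) v·𝟙≡m)

corollary5p1 : (n : ℕ) (G : PermGroup n) → Transitive G →
    Nonspreading G ⇔
    (Σ (Fin n → ℚ) λ u → Σ (Fin n → ℚ) λ v →
       NontrivialℚVec n u × NontrivialℚVec n v ×
       (∀ ω → u ω ≡ 0ℚ ⊎ u ω ≡ 1ℚ) ×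
       (∀ ω → ∃ λ m → v ω ≡ ℕ→ℚ m) ×
       (∃ λ m → (v · 𝟙) ≡ ℕ→ℚ m × m ∣ n) ×
       (form v (D G u) v ≡
          recip (ℕ→ℚ (n * n)) ℚ.* ((u · 𝟙) ℚ.* (u · 𝟙)) ℚ.* ((v · 𝟙) ℚ.* (v · 𝟙))))
corollary5p1 n G transitive = mk⇔ (nonspreading⇒certificate G transitive) (certificate⇒nonspreading G transitive)
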